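{- Fix a finite signature $\sigma$. There exists an algorithm that, given as input a finite structure $\mathbf{B}$ over $\sigma$, outputs a finite list $(\beta_1,\mathbf{B}_1),\ldots,(\beta_k,\mathbf{B}_k)$ of pairs with $\beta_i \in \mathbb{Q}$ and $\mathbf{B}_i$ a finite structure over $\sigma$, where the values $\beta_i$ are non-zero and the structures $\mathbf{B}_i$ are pairwise non-isomorphic, such that for all finite structures $\mathbf{A}$ over $\sigma$, $$\mathrm{Condens}(\mathbf{A},\mathbf{B}) = \beta_1 \cdot \mathrm{Hom}(\mathbf{A},\mathbf{B}_1) + \cdots + \beta_k \cdot \mathrm{Hom}(\mathbf{A},\mathbf{B}_k).$$
   Context: A signature is a finite set of relation symbols, each with an arity. A (finite) structure $\mathbf{B}$ over $\sigma$ consists of a finite universe $B$ and a relation $R^{\mathbf{B}} \subseteq B^{\mathrm{ar}(R)}$ for each $R\in\sigma$. A homomorphism from $\mathbf{A}$ to $\mathbf{B}$ (same signature) is a map $h:A\to B$ with $h(R^{\mathbf{A}})\subseteq R^{\mathbf{B}}$ for every $R\in\sigma$ ($h$ applied to tuples componentwise). A condensation from $\mathbf{A}$ to $\mathbf{B}$ is a homomorphism $h$ with $h(A)=B$ and $h(R^{\mathbf{A}})=R^{\mathbf{B}}$ for every $R\in\sigma$. $\mathrm{Hom}(\mathbf{A},\mathbf{B})$ denotes the number of homomorphisms from $\mathbf{A}$ to $\mathbf{B}$, and $\mathrm{Condens}(\mathbf{A},\mathbf{B})$ the number of condensations from $\mathbf{A}$ to $\mathbf{B}$. -}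

module Defs where

open import Data.Nat using (ℕ; zero; suc)
open import Data.Bool using (Bool; true; false; _∧_; _∨_; not; if_then_else_)
open import Data.Fin using (Fin)
open import Data.Fin.Properties using () renaming (_≟_ to _≟ᶠ_)
open import Data.Vec using (Vec; []; _∷_; lookup)
import Data.Vec as Vec
open import Data.Vec.Properties using (≡-dec)
open import Data.List using (List; []; _∷_; _++_; concatMap; map; length; filter; foldr)
open import Data.Bool.ListAction using (all; any)
open import Data.Product using (Σ; _×_; _,_; proj₁; proj₂)
open import Relation.Nullary using (¬_)
open import Relation.Nullary.Decidable using (⌊_⌋)
open import Relation.Binary.PropositionalEquality using (_≡_)
open import Data.Integer using (+_)
open import Data.Rational using (ℚ; _/_; 0ℚ) renaming (_+_ to _+ℚ_; _*_ to _*ℚ_)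

record Signature : Set where
  field
    nsym : ℕ
    ar   : Fin nsym → ℕ
open Signature public

record Structure (σ : Signature) : Set where
  field
    size : ℕ
    rel  : (R : Fin (nsym σ)) → Vec (Fin size) (ar σ R) → Bool
open Structure public

allFin : (n : ℕ) → List (Fin n)
allFin n = Data.List.tabulate (λ i → i)

allVecs : (a b : ℕ) → List (Vec (Fin b) a)
allVecs zero    b = [] ∷ []
allVecs (suc a) b = concatMap (λ x → map (x ∷_) (allVecs a b)) (allFin b)

Map : ∀ {σ} → Structure σ → Structure σ → Set
Map A B = Vec (Fin (size B)) (size A)

apply : ∀ {m n k} → Vec (Fin n) m → Vec (Fin m) k → Vec (Fin n) k
apply h t = Vec.map (lookup h) t

_⇒ᵇ_ : Bool → Bool → Bool
x ⇒ᵇ y = not x ∨ y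

isHom : ∀ {σ} (A B : Structure σ) → Map A B → Bool
isHom {σ} A B h =
  all (λ R → all (λ t → rel A R t ⇒ᵇ rel B R (apply h t)) (allVecs (ar σ R) (size A)))
      (allFin (nsym σ))

isSurj : ∀ {σ} (A B : Structure σ) → Map A B → Bool
isSurj A B h = all (λ y → any (λ x → ⌊ lookup h x ≟ᶠ y ⌋) (allFin (size A))) (allFin (size B))

relSurj : ∀ {σ} (A B : Structure σ) → Map A B → Bool
relSurj {σ} A B h =
  all (λ R → all (λ u → rel B R u ⇒ᵇ
                     any (λ t → rel A R t ∧ ⌊ ≡-dec _≟ᶠ_ (apply h t) u ⌋)
                         (allVecs (ar σ R) (size A)))
                 (allVecs (ar σ R) (size B)))
      (allFin (nsym σ))

isCondens : ∀ {σ} (A B : Structure σ) → Map A B → Bool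
isCondens A B h = isHom A B h ∧ isSurj A B h ∧ relSurj A B h

Hom : ∀ {σ} (A B : Structure σ) → ℕ
Hom A B = length (filter (λ h → isHom A B h Data.Bool.≟ true) (allVecs (size A) (size B)))

Condens : ∀ {σ} (A B : Structure σ) → ℕ
Condens A B = length (filter (λ h → isCondens A B h Data.Bool.≟ true) (allVecs (size A) (size B)))

Iso : ∀ {σ} (A B : Structure σ) → Set
Iso A B = Σ (Map A B) λ h → Σ (Map B A) λ g →
  (isHom A B h ≡ true) × (isHom B A g ≡ true) ×
  (∀ x → lookup g (lookup h x) ≡ x) × (∀ y → lookup h (lookup g y) ≡ y)

toℚ : ℕ → ℚ
toℚ n = + n / 1

linComb : ∀ {σ} → List (ℚ × Structure σ) → Structure σ → ℚ
linComb L A = foldr (λ p acc → (proj₁ p *ℚ toℚ (Hom A (proj₂ p))) +ℚ acc) 0ℚ L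

module Submission where

-- A condensation A → B is a homomorphism that hits every element and every
-- tuple of B.  We count the homomorphisms that cover a list of tuples and a list
-- of (labelled) elements of B, and remove these covering conditions one at a
-- time by inclusion–exclusion:
--   * the homomorphisms missing a tuple p are exactly the homomorphisms into B
--     with p removed (removeTuple-hom);
--   * the homomorphisms missing an element z correspond, via punchIn z, to the
--     homomorphisms into B with z deleted (count-along, a change of variables
--     for counting vectors).
-- Unfolding these recurrences yields a formal combination of structures whose
-- value at every A is Condens(A, B) (expansion-correct).  Merging isomorphic
-- structures (isomorphic targets have equal Hom counts, Hom-iso) and dropping
-- zero coefficients normalizes it without changing its value.

open import Defs
import Algebra.Properties.CommutativeMonoid.Sum as Sum
open import Data.Bool as Bool using (Bool; true; false; T; _∧_; not; if_then_else_)
open import Data.Bool.ListAction using (and; all; any)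
open import Data.Bool.Properties using (T-∧; T-≡; ∧-assoc; ∧-identityʳ; ∧-zeroʳ)
open import Data.Bool.Solver using (module ∨-∧-Solver)
open import Data.Empty using (⊥-elim)
open import Data.Fin as Fin using (Fin; punchIn; punchOut)
open import Data.Fin.Permutation using (permutation)
open import Data.Fin.Properties
  using (punchInᵢ≢i; punchIn-injective; punchIn-punchOut; all?) renaming (_≟_ to _≟ᶠ_)
import Data.Integer as ℤ
import Data.Integer.Properties as ℤₚ
open import Data.List using (List; []; _∷_; _++_; map; concatMap; length; filter; filterᵇ; tabulate; foldr)
open import Data.List.Membership.Propositional using (_∈_; lose)
open import Data.List.Membership.Propositional.Properties using (∈-allFin; ∈-concatMap⁺; ∈-map⁺)
open import Data.List.Properties using (filter-++; length-++; map-cong; map-∘)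
open import Data.List.Relation.Unary.All as All using (All; []; _∷_)
open import Data.List.Relation.Unary.All.Properties using (all⁺; all⁻; all-filter)
open import Data.List.Relation.Unary.AllPairs using (AllPairs; []; _∷_)
import Data.List.Relation.Unary.AllPairs.Properties as AllPairsₚ
import Data.List.Relation.Unary.Any as Any
open import Data.List.Relation.Unary.Any.Properties using (any⁺; any⁻)
open import Data.Maybe using (Maybe; just; nothing; _>>=_)
open import Data.Nat using (ℕ; zero; suc; _+_)
open import Data.Nat.Coprimality as Coprime using ()
open import Data.Nat.Properties using (+-0-commutativeMonoid; +-identityʳ)
open import Data.Product using (Σ; ∃; _×_; _,_; proj₁; proj₂)
import Data.Product.Properties as Productₚ
open import Data.Rational using (ℚ; 0ℚ; 1ℚ; mkℚ; _/_; -_; _-_) renaming (_+_ to _+ℚ_; _*_ to _*ℚ_)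
import Data.Rational.Properties as ℚₚ
open import Data.Rational.Solver using (module +-*-Solver)
open import Data.Vec as Vec using (Vec; []; _∷_; lookup)
import Data.Vec.Properties as Vecₚ
open import Function using (_∘_; _⇔_; mk⇔; Equivalence)
open import Relation.Binary.Definitions using (DecidableEquality)
open import Relation.Binary.PropositionalEquality
open import Relation.Nullary using (Dec; yes; no; ¬_; ¬?)
open import Relation.Nullary.Decidable using (map′; ⌊_⌋; toWitness; fromWitness; _×-dec_)
open import Relation.Nullary.Negation using (contradiction)

open Equivalence using (to; from)
open Sum +-0-commutativeMonoid using (sum; sum-cong-≗; ∑-distrib-+; sum-replicate-zero; sum-remove; sum-permute)

private variable
  X Y : Set

Enumerates : List X → Set
Enumerates {X} xs = (x : X) → x ∈ xs

module _ {xs : List X} (enum : Enumerates xs) where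

  all-enum : (p : X → Bool) → T (all p xs) ⇔ (∀ x → T (p x))
  all-enum p = mk⇔ (λ a x → All.lookup (all⁺ p xs a) (enum x))
                   (λ f → all⁻ p {xs} (All.tabulate (λ {x} _ → f x)))

  any-enum : (p : X → Bool) → T (any p xs) ⇔ ∃ (T ∘ p)
  any-enum p = mk⇔ (Any.satisfied ∘ any⁻ p xs) (λ (x , px) → any⁺ p (lose (enum x) px))

  search : {P : X → Set} → (∀ x → Dec (P x)) → Dec (∃ P)
  search P? = map′ Any.satisfied (λ (x , px) → lose (enum x) px) (Any.any? P? xs)

enum-allFin : ∀ n → Enumerates (allFin n)
enum-allFin n = ∈-allFin

enum-allVecs : ∀ a b → Enumerates (allVecs a b)
enum-allVecs zero    b []      = Any.here refl
enum-allVecs (suc a) b (x ∷ t) =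
  ∈-concatMap⁺ (λ y → map (y ∷_) (allVecs a b))
    (lose (enum-allFin b x) (∈-map⁺ (x ∷_) (enum-allVecs a b t)))

T-ext : ∀ {x y} → (T x ⇔ T y) → x ≡ y
T-ext {true}  {true}  _ = refl
T-ext {true}  {false} e = ⊥-elim (to e _)
T-ext {false} {true}  e = ⊥-elim (from e _)
T-ext {false} {false} _ = refl

T-not : ∀ {x} → T (not x) ⇔ (¬ T x)
T-not {true}  = mk⇔ (λ ()) (λ f → f _)
T-not {false} = mk⇔ (λ _ ()) (λ _ → _)

T-⇒ᵇ : ∀ {x y} → T (x ⇒ᵇ y) ⇔ (T x → T y)
T-⇒ᵇ {true}  = mk⇔ (λ y _ → y) (λ f → f _)
T-⇒ᵇ {false} = mk⇔ (λ _ ()) (λ _ → _)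

all-cong : ∀ {p q : X → Bool} → (∀ x → p x ≡ q x) → ∀ xs → all p xs ≡ all q xs
all-cong eq xs = cong and (map-cong eq xs)

all-++ : ∀ (p : X → Bool) xs ys → all p (xs ++ ys) ≡ all p xs ∧ all p ys
all-++ p []       ys = refl
all-++ p (x ∷ xs) ys = trans (cong (p x ∧_) (all-++ p xs ys)) (sym (∧-assoc (p x) (all p xs) (all p ys)))

all-concatMap : ∀ (p : Y → Bool) (f : X → List Y) xs → all p (concatMap f xs) ≡ all (all p ∘ f) xs
all-concatMap p f []       = refl
all-concatMap p f (x ∷ xs) =
  trans (all-++ p (f x) (concatMap f xs)) (cong (all p (f x) ∧_) (all-concatMap p f xs))

all-map : ∀ (p : Y → Bool) (f : X → Y) xs → all p (map f xs) ≡ all (p ∘ f) xs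
all-map p f xs = cong and (sym (map-∘ xs))

all-filterᵇ : ∀ (p q : X → Bool) xs → all p (filterᵇ q xs) ≡ all (λ x → q x ⇒ᵇ p x) xs
all-filterᵇ p q []       = refl
all-filterᵇ p q (x ∷ xs) with q x
... | true  = cong (p x ∧_) (all-filterᵇ p q xs)
... | false = all-filterᵇ p q xs

∧-slide₁ : ∀ w x y → w ∧ (x ∧ y) ≡ (x ∧ w) ∧ y
∧-slide₁ = solve 3 (λ w x y → w :* (x :* y) := (x :* w) :* y) refl
  where open ∨-∧-Solver

∧-slide₂ : ∀ w x y z → w ∧ (x ∧ (y ∧ z)) ≡ x ∧ ((w ∧ y) ∧ z)
∧-slide₂ = solve 4 (λ w x y z → w :* (x :* (y :* z)) := x :* ((w :* y) :* z)) refl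
  where open ∨-∧-Solver

∧-slide₃ : ∀ w x y z → w ∧ (x ∧ (y ∧ z)) ≡ x ∧ (y ∧ (w ∧ z))
∧-slide₃ = solve 4 (λ w x y z → w :* (x :* (y :* z)) := x :* (y :* (w :* z))) refl
  where open ∨-∧-Solver

indicator : Bool → ℕ
indicator b = if b then 1 else 0

count : ∀ {a b} → (Vec (Fin b) a → Bool) → ℕ
count {zero}      p = indicator (p [])
count {suc a} {b} p = sum λ x → count {a} (λ t → p (x ∷ t))

count-cong : ∀ {a b} {p q : Vec (Fin b) a → Bool} → (∀ h → p h ≡ q h) → count p ≡ count q
count-cong {zero}      eq = cong indicator (eq [])
count-cong {suc a} {b} eq = sum-cong-≗ {b} λ x → count-cong λ t → eq (x ∷ t)

count-false : ∀ a {b} → count {a} {b} (λ _ → false) ≡ 0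
count-false zero        = refl
count-false (suc a) {b} = trans (sum-cong-≗ {b} λ _ → count-false a) (sum-replicate-zero b)

count-split : ∀ {a b} (p q : Vec (Fin b) a → Bool) →
  count p ≡ count (λ h → q h ∧ p h) + count (λ h → not (q h) ∧ p h)
count-split {zero} p q with q []
... | true  = sym (+-identityʳ (indicator (p [])))
... | false = refl
count-split {suc a} {b} p q =
  trans (sum-cong-≗ {b} λ x → count-split (λ t → p (x ∷ t)) (λ t → q (x ∷ t)))
        (∑-distrib-+ (λ x → count (λ t → q (x ∷ t) ∧ p (x ∷ t)))
                     (λ x → count (λ t → not (q (x ∷ t)) ∧ p (x ∷ t))))

countList : (X → Bool) → List X → ℕ
countList p xs = length (filter (λ x → p x Bool.≟ true) xs)

countList-++ : ∀ (p : X → Bool) xs ys → countList p (xs ++ ys) ≡ countList p xs + countList p ys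
countList-++ p xs ys = trans (cong length (filter-++ _ xs ys)) (length-++ (filter _ xs))

countList-map : ∀ (p : Y → Bool) (f : X → Y) xs → countList p (map f xs) ≡ countList (p ∘ f) xs
countList-map p f []       = refl
countList-map p f (x ∷ xs) with p (f x)
... | true  = cong suc (countList-map p f xs)
... | false = countList-map p f xs

countList-concatMap : ∀ {n} (p : Y → Bool) (f : X → List Y) (g : Fin n → X) →
  countList p (concatMap f (tabulate g)) ≡ sum (λ i → countList p (f (g i)))
countList-concatMap {n = zero}  p f g = refl
countList-concatMap {n = suc n} p f g =
  trans (countList-++ p (f (g Fin.zero)) _)
        (cong (countList p (f (g Fin.zero)) +_) (countList-concatMap p f (g ∘ Fin.suc)))

countList-allVecs : ∀ a b (p : Vec (Fin b) a → Bool) → countList p (allVecs a b) ≡ count p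
countList-allVecs zero b p with p []
... | true  = refl
... | false = refl
countList-allVecs (suc a) b p =
  trans (countList-concatMap p (λ x → map (x ∷_) (allVecs a b)) (λ x → x))
        (sum-cong-≗ λ x → trans (countList-map p (x ∷_) (allVecs a b))
                                (countList-allVecs a b (λ t → p (x ∷ t))))

-- e : Fin m → Fin n has image described by img when summing over the image
-- equals summing along e.
SumsAlong : ∀ {m n} → (Fin m → Fin n) → (Fin n → Bool) → Set
SumsAlong {m} {n} e img =
  ∀ (F : Fin n → ℕ) → sum (λ x → if img x then F x else 0) ≡ sum (λ x′ → F (e x′))

bijection-sumsAlong : ∀ {m n} (e : Fin m → Fin n) (e⁻¹ : Fin n → Fin m) →
  (∀ y → e (e⁻¹ y) ≡ y) → (∀ x → e⁻¹ (e x) ≡ x) → SumsAlong e (λ _ → true)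
bijection-sumsAlong e e⁻¹ inv₁ inv₂ F = sum-permute F (permutation e e⁻¹ inv₁ inv₂)

punchIn-sumsAlong : ∀ {m} (z : Fin (suc m)) → SumsAlong (punchIn z) (λ x → not ⌊ x ≟ᶠ z ⌋)
punchIn-sumsAlong {m} z F =
  trans (sum-remove {i = z} (λ x → if not ⌊ x ≟ᶠ z ⌋ then F x else 0))
        (cong₂ _+_ skip-z (sum-cong-≗ {m} keep-rest))
  where
  skip-z : (if not ⌊ z ≟ᶠ z ⌋ then F z else 0) ≡ 0
  skip-z with z ≟ᶠ z
  ... | yes _   = refl
  ... | no z≢z = contradiction refl z≢z
  keep-rest : ∀ x′ → (if not ⌊ punchIn z x′ ≟ᶠ z ⌋ then F (punchIn z x′) else 0)
                    ≡ F (punchIn z x′)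
  keep-rest x′ with punchIn z x′ ≟ᶠ z
  ... | yes eq = contradiction eq (punchInᵢ≢i z x′)
  ... | no _   = refl

everywhere : ∀ {a n} → (Fin n → Bool) → Vec (Fin n) a → Bool
everywhere img []      = true
everywhere img (x ∷ t) = img x ∧ everywhere img t

everywhere-spec : ∀ {a n} (img : Fin n → Bool) (h : Vec (Fin n) a) →
  T (everywhere img h) ⇔ (∀ i → T (img (lookup h i)))
everywhere-spec img []      = mk⇔ (λ _ ()) (λ _ → _)
everywhere-spec img (x ∷ h) = mk⇔
  (λ H → let (hx , hh) = to T-∧ H in λ { Fin.zero → hx ; (Fin.suc i) → to (everywhere-spec img h) hh i })
  (λ H → from T-∧ (H Fin.zero , from (everywhere-spec img h) (H ∘ Fin.suc)))

everywhere-true : ∀ {a n} (h : Vec (Fin n) a) → everywhere (λ _ → true) h ≡ true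
everywhere-true []      = refl
everywhere-true (_ ∷ h) = everywhere-true h

count-along : ∀ {m n} {e : Fin m → Fin n} {img : Fin n → Bool} → SumsAlong e img →
  ∀ {a} (P : Vec (Fin n) a → Bool) →
  count (λ h → everywhere img h ∧ P h) ≡ count (λ h′ → P (Vec.map e h′))
count-along along {zero}  P = refl
count-along {m} {n} {e} {img} along {suc a} P = begin
  sum (λ x → count (λ t → (img x ∧ everywhere img t) ∧ P (x ∷ t)))
    ≡⟨ sum-cong-≗ {n} restrict ⟩
  sum (λ x → if img x then count (λ t → everywhere img t ∧ P (x ∷ t)) else 0)
    ≡⟨ along _ ⟩
  sum (λ x′ → count (λ t → everywhere img t ∧ P (e x′ ∷ t)))
    ≡⟨ sum-cong-≗ {m} (λ x′ → count-along along (λ t → P (e x′ ∷ t))) ⟩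
  sum (λ x′ → count (λ t′ → P (e x′ ∷ Vec.map e t′)))  ∎
  where
  open ≡-Reasoning
  restrict : ∀ x → count (λ t → (img x ∧ everywhere img t) ∧ P (x ∷ t))
                 ≡ (if img x then count (λ t → everywhere img t ∧ P (x ∷ t)) else 0)
  restrict x with img x
  ... | true  = refl
  ... | false = count-false a

apply-map : ∀ {m n k j} (f : Fin n → Fin j) (h : Vec (Fin n) m) (t : Vec (Fin m) k) →
  apply (Vec.map f h) t ≡ Vec.map f (apply h t)
apply-map f h t = trans (Vecₚ.map-cong (λ x → Vecₚ.lookup-map x f h) t) (Vecₚ.map-∘ f (lookup h) t)

module _ {σ : Signature} where

  IsHom : (A B : Structure σ) → Map A B → Set
  IsHom A B h = ∀ R t → T (rel A R t) → T (rel B R (apply h t))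

  isHom-spec : ∀ (A B : Structure σ) h → T (isHom A B h) ⇔ IsHom A B h
  isHom-spec A B h = mk⇔
    (λ H R t → to T-⇒ᵇ (to (all-enum (enum-allVecs _ _) _) (to (all-enum (enum-allFin _) _) H R) t))
    (λ H → from (all-enum (enum-allFin _) _) λ R →
             from (all-enum (enum-allVecs _ _) _) λ t → from T-⇒ᵇ (H R t))

  isHom-∘ : ∀ (A B C : Structure σ) h g → T (isHom A B h) → T (isHom B C g) →
    T (isHom A C (Vec.map (lookup g) h))
  isHom-∘ A B C h g Hh Hg = from (isHom-spec A C (Vec.map (lookup g) h)) λ R t r →
    subst (T ∘ rel C R) (sym (apply-map (lookup g) h t))
      (to (isHom-spec B C g) Hg R (apply h t) (to (isHom-spec A B h) Hh R t r))

  Hom-count : ∀ (A B : Structure σ) → Hom A B ≡ count (isHom A B)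
  Hom-count A B = countList-allVecs (size A) (size B) (isHom A B)

  -- Isomorphic targets receive equally many homomorphisms: composing with the
  -- isomorphism f is a change of variables that preserves being a homomorphism.
  Hom-iso : ∀ (A C D : Structure σ) → Iso C D → Hom A C ≡ Hom A D
  Hom-iso A C D (f , g , Hf , Hg , gf , fg) = begin
    Hom A C                                             ≡⟨ Hom-count A C ⟩
    count (isHom A C)                                   ≡⟨ count-cong transport ⟨
    count (λ h → isHom A D (Vec.map (lookup f) h))      ≡⟨ count-along along (isHom A D) ⟨
    count (λ h → everywhere (λ _ → true) h ∧ isHom A D h)
      ≡⟨ count-cong (λ h → cong (_∧ isHom A D h) (everywhere-true h)) ⟩
    count (isHom A D)                                   ≡⟨ Hom-count A D ⟨
    Hom A D                                             ∎
    where
    open ≡-Reasoning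
    along : SumsAlong (lookup f) (λ _ → true)
    along = bijection-sumsAlong (lookup f) (lookup g) fg gf
    g∘f≡id : ∀ {a} (h : Vec (Fin (size C)) a) → Vec.map (lookup g) (Vec.map (lookup f) h) ≡ h
    g∘f≡id h = trans (sym (Vecₚ.map-∘ (lookup g) (lookup f) h))
                     (trans (Vecₚ.map-cong gf h) (Vecₚ.map-id h))
    transport : ∀ h → isHom A D (Vec.map (lookup f) h) ≡ isHom A C h
    transport h = T-ext (mk⇔
      (λ H → subst (T ∘ isHom A C) (g∘f≡id h) (isHom-∘ A D C (Vec.map (lookup f) h) g H (from T-≡ Hg)))
      (λ H → isHom-∘ A C D h f H (from T-≡ Hf)))

  Iso? : ∀ (C D : Structure σ) → Dec (Iso C D)
  Iso? C D =
    search (enum-allVecs _ _) λ h → search (enum-allVecs _ _) λ g →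
      (isHom C D h Bool.≟ true) ×-dec (isHom D C g Bool.≟ true) ×-dec
      all? (λ x → lookup g (lookup h x) ≟ᶠ x) ×-dec all? (λ y → lookup h (lookup g y) ≟ᶠ y)

  Tuple : ℕ → Set
  Tuple n = Σ (Fin (nsym σ)) λ R → Vec (Fin n) (ar σ R)

  _≟ᵗ_ : ∀ {n} → DecidableEquality (Tuple n)
  _≟ᵗ_ = Productₚ.≡-dec _≟ᶠ_ (Vecₚ.≡-dec _≟ᶠ_)

  tuples : (B : Structure σ) → List (Tuple (size B))
  tuples B = concatMap (λ R → map (R ,_) (filterᵇ (rel B R) (allVecs (ar σ R) (size B))))
                       (allFin (nsym σ))

  removeTuple : (B : Structure σ) → Tuple (size B) → Structure σ
  removeTuple B p = record { size = size B ; rel = λ R u → rel B R u ∧ not ⌊ (R , u) ≟ᵗ p ⌋ }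

  -- B with the element z deleted; punchIn z maps the new universe onto the
  -- old one without z.
  delete : (B : Structure σ) → Fin (size B) → Structure σ
  delete record { size = suc m ; rel = r } z =
    record { size = m ; rel = λ R u → r R (Vec.map (punchIn z) u) }

punchOut? : ∀ {m} → Fin (suc m) → Fin (suc m) → Maybe (Fin m)
punchOut? z w with z ≟ᶠ w
... | yes _   = nothing
... | no z≢w = just (punchOut z≢w)

deleteLabel : ∀ {σ} (B : Structure σ) (z : Fin (size B)) → Fin (size B) → Maybe (Fin (size (delete B z)))
deleteLabel record { size = suc m } z = punchOut? z

module Hits {σ : Signature} (A : Structure σ) where

  hitsElem : ∀ {b} → Vec (Fin b) (size A) → Fin b → Bool
  hitsElem h y = any (λ x → ⌊ lookup h x ≟ᶠ y ⌋) (allFin (size A))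

  hitsLabel : ∀ {b} → Vec (Fin b) (size A) → Maybe (Fin b) → Bool
  hitsLabel h nothing  = false
  hitsLabel h (just y) = hitsElem h y

  hitsTuple : ∀ {b} → Vec (Fin b) (size A) → Tuple b → Bool
  hitsTuple h (R , u) =
    any (λ t → rel A R t ∧ ⌊ Vecₚ.≡-dec _≟ᶠ_ (apply h t) u ⌋) (allVecs (ar σ R) (size A))

  hitsElem-spec : ∀ {b} (h : Vec (Fin b) (size A)) y → T (hitsElem h y) ⇔ ∃ λ x → lookup h x ≡ y
  hitsElem-spec h y = mk⇔
    (λ H → let (x , e) = to (any-enum (enum-allFin _) _) H in x , toWitness e)
    (λ (x , e) → from (any-enum (enum-allFin _) _) (x , fromWitness e))

  hitsTuple-spec : ∀ {b} (h : Vec (Fin b) (size A)) R u →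
    T (hitsTuple h (R , u)) ⇔ ∃ λ t → T (rel A R t) × apply h t ≡ u
  hitsTuple-spec h R u = mk⇔
    (λ H → let (t , e) = to (any-enum (enum-allVecs _ _) _) H
               (r , q) = to T-∧ e
           in t , r , toWitness q)
    (λ (t , r , q) → from (any-enum (enum-allVecs _ _) _) (t , from T-∧ (r , fromWitness q)))

  relSurj-tuples : ∀ (B : Structure σ) h → relSurj A B h ≡ all (hitsTuple h) (tuples B)
  relSurj-tuples B h = sym (begin
    all (hitsTuple h) (tuples B)
      ≡⟨ all-concatMap (hitsTuple h) (λ R → map (R ,_) (tuplesOf R)) (allFin (nsym σ)) ⟩
    all (λ R → all (hitsTuple h) (map (R ,_) (tuplesOf R))) (allFin (nsym σ))
      ≡⟨ all-cong (λ R → trans (all-map (hitsTuple h) (R ,_) (tuplesOf R))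
                               (all-filterᵇ (λ u → hitsTuple h (R , u)) (rel B R) (allVecs (ar σ R) (size B))))
                  (allFin (nsym σ)) ⟩
    relSurj A B h ∎)
    where
    open ≡-Reasoning
    tuplesOf = λ R → filterᵇ (rel B R) (allVecs (ar σ R) (size B))

  removeTuple-hom : ∀ (B : Structure σ) p h →
    isHom A (removeTuple B p) h ≡ isHom A B h ∧ not (hitsTuple h p)
  removeTuple-hom B p@(R₀ , u₀) h = T-ext (mk⇔ forward backward)
    where
    B⁻ = removeTuple B p
    hit : ∀ {R t} → T (rel A R t) → (R , apply h t) ≡ p → T (hitsTuple h p)
    hit {R} {t} r eq = subst (T ∘ hitsTuple h) eq (from (hitsTuple-spec h R (apply h t)) (t , r , refl))

    forward : T (isHom A B⁻ h) → T (isHom A B h ∧ not (hitsTuple h p))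
    forward H = from T-∧ (from (isHom-spec A B h) (λ R t r → proj₁ (to T-∧ (hom R t r))) ,
                          from T-not λ hits → let (t , r , e) = to (hitsTuple-spec h R₀ u₀) hits in
                            not-removed t r (fromWitness (cong (R₀ ,_) e)))
      where
      hom = to (isHom-spec A B⁻ h) H
      not-removed : ∀ t → T (rel A R₀ t) → ¬ T ⌊ (R₀ , apply h t) ≟ᵗ p ⌋
      not-removed t r = to T-not (proj₂ (to (T-∧ {rel B R₀ (apply h t)}) (hom R₀ t r)))

    backward : T (isHom A B h ∧ not (hitsTuple h p)) → T (isHom A B⁻ h)
    backward H = from (isHom-spec A B⁻ h) λ R t r →
      from T-∧ (to (isHom-spec A B h) hom R t r , from T-not λ eq → to T-not miss (hit r (toWitness eq)))
      where
      hom  = proj₁ (to T-∧ H)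
      miss = proj₂ (to T-∧ H)

  avoid-elem : ∀ {b} (h : Vec (Fin b) (size A)) z →
    not (hitsElem h z) ≡ everywhere (λ y → not ⌊ y ≟ᶠ z ⌋) h
  avoid-elem h z = T-ext (mk⇔
    (λ miss → from (everywhere-spec _ h) λ i → from T-not λ e →
                to T-not miss (from (hitsElem-spec h z) (i , toWitness e)))
    (λ avoid → from T-not λ hit → let (i , e) = to (hitsElem-spec h z) hit in
                 to T-not (to (everywhere-spec _ h) avoid i) (fromWitness e)))

  hitsElem-map : ∀ {m n} (f : Fin m → Fin n) (h : Vec (Fin m) (size A)) y →
    T (hitsElem (Vec.map f h) y) ⇔ ∃ λ x → f (lookup h x) ≡ y
  hitsElem-map f h y = mk⇔
    (λ hit → let (x , e) = to (hitsElem-spec (Vec.map f h) y) hit in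
               x , trans (sym (Vecₚ.lookup-map x f h)) e)
    (λ (x , e) → from (hitsElem-spec (Vec.map f h) y) (x , trans (Vecₚ.lookup-map x f h) e))

  hitsElem-punchIn : ∀ {m} (z : Fin (suc m)) (h : Vec (Fin m) (size A)) w →
    hitsLabel (Vec.map (punchIn z) h) (just w) ≡ hitsLabel h (punchOut? z w)
  hitsElem-punchIn z h w with z ≟ᶠ w
  ... | yes refl = T-ext (mk⇔ (λ hit → let (x , e) = to (hitsElem-map (punchIn z) h z) hit in
                                         ⊥-elim (punchInᵢ≢i z (lookup h x) e))
                              λ ())
  ... | no z≢w = T-ext (mk⇔
    (λ hit → let (x , e) = to (hitsElem-map (punchIn z) h w) hit in
      from (hitsElem-spec h _) (x , punchIn-injective z _ _ (trans e (sym (punchIn-punchOut z≢w)))))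
    (λ hit → let (x , e) = to (hitsElem-spec h _) hit in
      from (hitsElem-map (punchIn z) h w) (x , trans (cong (punchIn z) e) (punchIn-punchOut z≢w))))

  hitsLabel-punchIn : ∀ {m} (z : Fin (suc m)) (h : Vec (Fin m) (size A)) ℓ →
    hitsLabel (Vec.map (punchIn z) h) ℓ ≡ hitsLabel h (ℓ >>= punchOut? z)
  hitsLabel-punchIn z h nothing  = refl
  hitsLabel-punchIn z h (just w) = hitsElem-punchIn z h w

-- Counting homomorphisms that cover prescribed parts of the target.  Elements
-- to be covered are named by labels y ∈ Fin k through ρ, so that deleting an
-- element of B only renumbers the labels.
module Covers {σ : Signature} (A : Structure σ) where
  open Hits A

  covers : ∀ (B : Structure σ) {k} → (Fin k → Maybe (Fin (size B))) →
           List (Tuple (size B)) → List (Fin k) → Map A B → Bool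
  covers B ρ T E h = isHom A B h ∧ (all (hitsLabel h ∘ ρ) E ∧ all (hitsTuple h) T)

  #covers : ∀ (B : Structure σ) {k} → (Fin k → Maybe (Fin (size B))) →
            List (Tuple (size B)) → List (Fin k) → ℕ
  #covers B ρ T E = count (covers B ρ T E)

  -- covers B ρ [] (y ∷ E), with the label y taken to name ℓ.
  coversWith : ∀ B {k} → (Fin k → Maybe (Fin (size B))) → List (Fin k) → Maybe (Fin (size B)) → Map A B → Bool
  coversWith B ρ E ℓ h = isHom A B h ∧ ((hitsLabel h ℓ ∧ all (hitsLabel h ∘ ρ) E) ∧ true)

  Condens-covers : ∀ B → Condens A B ≡ #covers B just (tuples B) (allFin (size B))
  Condens-covers B =
    trans (countList-allVecs (size A) (size B) (isCondens A B))
          (count-cong λ h → cong (λ c → isHom A B h ∧ (isSurj A B h ∧ c)) (relSurj-tuples B h))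

  #covers-[] : ∀ B {k} (ρ : Fin k → Maybe (Fin (size B))) → #covers B ρ [] [] ≡ Hom A B
  #covers-[] B ρ = trans (count-cong (λ h → ∧-identityʳ (isHom A B h))) (sym (Hom-count A B))

  -- Covering the tuple p too: the maps missing p are the covering maps into B
  -- with p removed.
  #covers-tuple : ∀ B {k} (ρ : Fin k → Maybe (Fin (size B))) p T E →
    #covers B ρ (p ∷ T) E + #covers (removeTuple B p) ρ T E ≡ #covers B ρ T E
  #covers-tuple B ρ p T E = sym (begin
    count (covers B ρ T E)
      ≡⟨ count-split (covers B ρ T E) (λ h → hitsTuple h p) ⟩
    count (λ h → hitsTuple h p ∧ covers B ρ T E h) + count (λ h → not (hitsTuple h p) ∧ covers B ρ T E h)
      ≡⟨ cong₂ _+_ (count-cong hit) (count-cong miss) ⟩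
    count (covers B ρ (p ∷ T) E) + count (covers (removeTuple B p) ρ T E) ∎)
    where
    open ≡-Reasoning
    hit : ∀ h → hitsTuple h p ∧ covers B ρ T E h ≡ covers B ρ (p ∷ T) E h
    hit h = ∧-slide₃ (hitsTuple h p) (isHom A B h) (all (hitsLabel h ∘ ρ) E) (all (hitsTuple h) T)
    miss : ∀ h → not (hitsTuple h p) ∧ covers B ρ T E h ≡ covers (removeTuple B p) ρ T E h
    miss h = trans (∧-slide₁ (not (hitsTuple h p)) (isHom A B h) _)
                   (cong (_∧ _) (sym (removeTuple-hom B p h)))

  #covers-undefined : ∀ B {k} (ρ : Fin k → Maybe (Fin (size B))) y E →
    ρ y ≡ nothing → #covers B ρ [] (y ∷ E) ≡ 0
  #covers-undefined B ρ y E eq = trans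
    (count-cong λ h → trans (cong (λ ℓ → coversWith B ρ E ℓ h) eq)
                            (∧-zeroʳ (isHom A B h)))
    (count-false (size A))

  -- Covering the element z labelled y too: the maps missing z are, pushed
  -- forward along punchIn z, the covering maps into B with z deleted.
  #covers-delete : ∀ B {k} (ρ : Fin k → Maybe (Fin (size B))) y z E → ρ y ≡ just z →
    #covers B ρ [] (y ∷ E) + #covers (delete B z) (λ y′ → ρ y′ >>= deleteLabel B z) [] E
      ≡ #covers B ρ [] E
  #covers-delete B@record { size = suc m ; rel = r } ρ y z E eq = sym (begin
    count (covers B ρ [] E)
      ≡⟨ count-split (covers B ρ [] E) (λ h → hitsElem h z) ⟩
    count (λ h → hitsElem h z ∧ covers B ρ [] E h) + count (λ h → not (hitsElem h z) ∧ covers B ρ [] E h)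
      ≡⟨ cong₂ _+_ (count-cong hit) (count-cong miss) ⟩
    count (covers B ρ [] (y ∷ E))
      + count (λ h → everywhere (λ x → not ⌊ x ≟ᶠ z ⌋) h ∧ covers B ρ [] E h)
      ≡⟨ cong (count (covers B ρ [] (y ∷ E)) +_) (count-along (punchIn-sumsAlong z) (covers B ρ [] E)) ⟩
    count (covers B ρ [] (y ∷ E)) + count (λ h′ → covers B ρ [] E (Vec.map (punchIn z) h′))
      ≡⟨ cong (count (covers B ρ [] (y ∷ E)) +_) (count-cong pushforward) ⟩
    count (covers B ρ [] (y ∷ E)) + count (covers (delete B z) ρ′ [] E) ∎)
    where
    open ≡-Reasoning
    ρ′ = λ y′ → ρ y′ >>= punchOut? z
    hit : ∀ h → hitsElem h z ∧ covers B ρ [] E h ≡ covers B ρ [] (y ∷ E) h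
    hit h = trans (∧-slide₂ (hitsElem h z) (isHom A B h) (all (hitsLabel h ∘ ρ) E) true)
                  (cong (λ ℓ → coversWith B ρ E ℓ h) (sym eq))
    miss : ∀ h → not (hitsElem h z) ∧ covers B ρ [] E h
               ≡ everywhere (λ x → not ⌊ x ≟ᶠ z ⌋) h ∧ covers B ρ [] E h
    miss h = cong (_∧ covers B ρ [] E h) (avoid-elem h z)
    delete-hom : ∀ h′ → isHom A B (Vec.map (punchIn z) h′) ≡ isHom A (delete B z) h′
    delete-hom h′ =
      all-cong (λ R → all-cong (λ t → cong (λ v → rel A R t ⇒ᵇ r R v) (apply-map (punchIn z) h′ t))
                               (allVecs (ar σ R) (size A)))
               (allFin (nsym σ))
    pushforward : ∀ h′ → covers B ρ [] E (Vec.map (punchIn z) h′) ≡ covers (delete B z) ρ′ [] E h′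
    pushforward h′ = cong₂ (λ hom c → hom ∧ (c ∧ true)) (delete-hom h′)
                           (all-cong (λ y′ → hitsLabel-punchIn z h′ (ρ y′)) E)

toℚ-mkℚ : ∀ k → toℚ k ≡ mkℚ (ℤ.+ k) 0 (Coprime.sym (Coprime.1-coprimeTo k))
toℚ-mkℚ k = ℚₚ.normalize-coprime (Coprime.sym (Coprime.1-coprimeTo k))

toℚ-+ : ∀ m n → toℚ (m + n) ≡ toℚ m +ℚ toℚ n
toℚ-+ m n rewrite toℚ-mkℚ m | toℚ-mkℚ n =
  cong (_/ 1) (trans (ℤₚ.pos-+ m n)
                     (sym (cong₂ ℤ._+_ (ℤₚ.*-identityʳ (ℤ.+ m)) (ℤₚ.*-identityʳ (ℤ.+ n)))))

toℚ-difference : ∀ a b {c} → a + b ≡ c → toℚ a ≡ toℚ c - toℚ b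
toℚ-difference a b refl rewrite toℚ-+ a b =
  solve 2 (λ x y → x := (x :+ y) :- y) refl (toℚ a) (toℚ b)
  where open +-*-Solver

Combination : Signature → Set
Combination σ = List (ℚ × Structure σ)

module _ {σ : Signature} where

  _⊖_ : Combination σ → Combination σ → Combination σ
  L ⊖ M = L ++ map (λ (q , C) → (- q , C)) M

  linComb-⊖ : ∀ (L M : Combination σ) A → linComb (L ⊖ M) A ≡ linComb L A - linComb M A
  linComb-⊖ [] M A = trans (linComb-negate M) (sym (ℚₚ.+-identityˡ _))
    where
    linComb-negate : ∀ M → linComb (map (λ (q , C) → (- q , C)) M) A ≡ - linComb M A
    linComb-negate [] = refl
    linComb-negate ((q , C) ∷ M) = trans (cong ((- q) *ℚ toℚ (Hom A C) +ℚ_) (linComb-negate M))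
      (solve 3 (λ q h l → (:- q) :* h :+ (:- l) := :- (q :* h :+ l)) refl q (toℚ (Hom A C)) (linComb M A))
      where open +-*-Solver
  linComb-⊖ ((q , C) ∷ L) M A = trans (cong (q *ℚ toℚ (Hom A C) +ℚ_) (linComb-⊖ L M A))
    (solve 3 (λ x l m → x :+ (l :- m) := (x :+ l) :- m) refl (q *ℚ toℚ (Hom A C)) (linComb L A) (linComb M A))
    where open +-*-Solver

  expandLabels : ∀ (B : Structure σ) {k} → (Fin k → Maybe (Fin (size B))) → List (Fin k) → Combination σ
  expandAt : ∀ (B : Structure σ) {k} → (Fin k → Maybe (Fin (size B))) → List (Fin k) →
             Maybe (Fin (size B)) → Combination σ

  expandLabels B ρ []      = (1ℚ , B) ∷ []
  expandLabels B ρ (y ∷ E) = expandAt B ρ E (ρ y)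

  expandAt B ρ E nothing  = []
  expandAt B ρ E (just z) =
    expandLabels B ρ E ⊖ expandLabels (delete B z) (λ y′ → ρ y′ >>= deleteLabel B z) E

  expandTuples : ∀ (B : Structure σ) {k} → (Fin k → Maybe (Fin (size B))) →
                 List (Tuple (size B)) → List (Fin k) → Combination σ
  expandTuples B ρ []      E = expandLabels B ρ E
  expandTuples B ρ (p ∷ T) E = expandTuples B ρ T E ⊖ expandTuples (removeTuple B p) ρ T E

  expansion : Structure σ → Combination σ
  expansion B = expandTuples B just (tuples B) (allFin (size B))

module _ {σ : Signature} (A : Structure σ) where
  open Covers A

  expandLabels-correct : ∀ B {k} (ρ : Fin k → Maybe (Fin (size B))) E →
    toℚ (#covers B ρ [] E) ≡ linComb (expandLabels B ρ E) A
  expandAt-correct : ∀ B {k} (ρ : Fin k → Maybe (Fin (size B))) y E ℓ → ρ y ≡ ℓ →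
    toℚ (#covers B ρ [] (y ∷ E)) ≡ linComb (expandAt B ρ E ℓ) A

  expandLabels-correct B ρ [] = trans (cong toℚ (#covers-[] B ρ))
    (sym (trans (ℚₚ.+-identityʳ (1ℚ *ℚ toℚ (Hom A B))) (ℚₚ.*-identityˡ (toℚ (Hom A B)))))
  expandLabels-correct B ρ (y ∷ E) = expandAt-correct B ρ y E (ρ y) refl

  expandAt-correct B ρ y E nothing  eq = cong toℚ (#covers-undefined B ρ y E eq)
  expandAt-correct B ρ y E (just z) eq = begin
    toℚ (#covers B ρ [] (y ∷ E))
      ≡⟨ toℚ-difference _ (#covers (delete B z) ρ′ [] E) (#covers-delete B ρ y z E eq) ⟩
    toℚ (#covers B ρ [] E) - toℚ (#covers (delete B z) ρ′ [] E)
      ≡⟨ cong₂ _-_ (expandLabels-correct B ρ E) (expandLabels-correct (delete B z) ρ′ E) ⟩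
    linComb (expandLabels B ρ E) A - linComb (expandLabels (delete B z) ρ′ E) A
      ≡⟨ linComb-⊖ (expandLabels B ρ E) _ A ⟨
    linComb (expandLabels B ρ E ⊖ expandLabels (delete B z) ρ′ E) A ∎
    where
    open ≡-Reasoning
    ρ′ = λ y′ → ρ y′ >>= deleteLabel B z

  expandTuples-correct : ∀ B {k} (ρ : Fin k → Maybe (Fin (size B))) T E →
    toℚ (#covers B ρ T E) ≡ linComb (expandTuples B ρ T E) A
  expandTuples-correct B ρ []      E = expandLabels-correct B ρ E
  expandTuples-correct B ρ (p ∷ T) E = begin
    toℚ (#covers B ρ (p ∷ T) E)
      ≡⟨ toℚ-difference _ (#covers (removeTuple B p) ρ T E) (#covers-tuple B ρ p T E) ⟩
    toℚ (#covers B ρ T E) - toℚ (#covers (removeTuple B p) ρ T E)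
      ≡⟨ cong₂ _-_ (expandTuples-correct B ρ T E) (expandTuples-correct (removeTuple B p) ρ T E) ⟩
    linComb (expandTuples B ρ T E) A - linComb (expandTuples (removeTuple B p) ρ T E) A
      ≡⟨ linComb-⊖ (expandTuples B ρ T E) _ A ⟨
    linComb (expandTuples B ρ T E ⊖ expandTuples (removeTuple B p) ρ T E) A ∎
    where open ≡-Reasoning

  expansion-correct : ∀ B → toℚ (Condens A B) ≡ linComb (expansion B) A
  expansion-correct B = trans (cong toℚ (Condens-covers B))
                              (expandTuples-correct B just (tuples B) (allFin (size B)))

module _ {σ : Signature} where

  insert : ℚ × Structure σ → Combination σ → Combination σ
  insert (q , C) [] = (q , C) ∷ []
  insert (q , C) ((r , D) ∷ N) with Iso? D C
  ... | yes _ = (r +ℚ q , D) ∷ N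
  ... | no _  = (r , D) ∷ insert (q , C) N

  merge : Combination σ → Combination σ
  merge = foldr insert []

  dropZeros : Combination σ → Combination σ
  dropZeros = filter (λ p → ¬? (proj₁ p ℚₚ.≟ 0ℚ))

  normalize : Combination σ → Combination σ
  normalize = dropZeros ∘ merge

  NonIsomorphic : Combination σ → Set
  NonIsomorphic = AllPairs (λ p q → ¬ Iso (proj₂ p) (proj₂ q))

  insert-All : ∀ (P : Structure σ → Set) q C N →
    All (P ∘ proj₂) N → P C → All (P ∘ proj₂) (insert (q , C) N)
  insert-All P q C [] [] PC = PC ∷ []
  insert-All P q C ((r , D) ∷ N) (PD ∷ PN) PC with Iso? D C
  ... | yes _ = PD ∷ PN
  ... | no _  = PD ∷ insert-All P q C N PN PC

  insert-nonIsomorphic : ∀ q C N → NonIsomorphic N → NonIsomorphic (insert (q , C) N)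
  insert-nonIsomorphic q C [] [] = [] ∷ []
  insert-nonIsomorphic q C ((r , D) ∷ N) (D≇N ∷ N!) with Iso? D C
  ... | yes _   = D≇N ∷ N!
  ... | no D≇C = insert-All (λ X → ¬ Iso D X) q C N D≇N D≇C ∷ insert-nonIsomorphic q C N N!

  merge-nonIsomorphic : ∀ L → NonIsomorphic (merge L)
  merge-nonIsomorphic []            = []
  merge-nonIsomorphic ((q , C) ∷ L) = insert-nonIsomorphic q C (merge L) (merge-nonIsomorphic L)

  normalize-nonzero : ∀ L → All (λ p → proj₁ p ≢ 0ℚ) (normalize L)
  normalize-nonzero L = all-filter (λ p → ¬? (proj₁ p ℚₚ.≟ 0ℚ)) (merge L)

  normalize-nonIsomorphic : ∀ L → NonIsomorphic (normalize L)
  normalize-nonIsomorphic L = AllPairsₚ.filter⁺ (λ p → ¬? (proj₁ p ℚₚ.≟ 0ℚ)) (merge-nonIsomorphic L)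

  -- Normalizing does not change the value of a combination under any valuation
  -- invariant under isomorphism, such as C ↦ Hom(A, C).  (Stated for an abstract
  -- valuation, which also keeps these proofs from unfolding Hom.)
  module _ (val : Structure σ → ℚ) (val-iso : ∀ {C D} → Iso C D → val C ≡ val D) where

    eval : Combination σ → ℚ
    eval = foldr (λ p acc → proj₁ p *ℚ val (proj₂ p) +ℚ acc) 0ℚ

    insert-eval : ∀ q C N → eval (insert (q , C) N) ≡ q *ℚ val C +ℚ eval N
    insert-eval q C [] = refl
    insert-eval q C ((r , D) ∷ N) with Iso? D C
    ... | yes D≅C =
      trans (solve 4 (λ q r v l → (r :+ q) :* v :+ l := q :* v :+ (r :* v :+ l)) refl q r (val D) (eval N))
            (cong (λ v → q *ℚ v +ℚ (r *ℚ val D +ℚ eval N)) (val-iso D≅C))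
      where open +-*-Solver
    ... | no _ = trans (cong (r *ℚ val D +ℚ_) (insert-eval q C N))
      (solve 4 (λ x q v l → x :+ (q :* v :+ l) := q :* v :+ (x :+ l)) refl (r *ℚ val D) q (val C) (eval N))
      where open +-*-Solver

    merge-eval : ∀ L → eval (merge L) ≡ eval L
    merge-eval []            = refl
    merge-eval ((q , C) ∷ L) = trans (insert-eval q C (merge L)) (cong (q *ℚ val C +ℚ_) (merge-eval L))

    dropZeros-eval : ∀ L → eval (dropZeros L) ≡ eval L
    dropZeros-eval [] = refl
    dropZeros-eval ((q , C) ∷ L) with q ℚₚ.≟ 0ℚ
    ... | yes refl = trans (dropZeros-eval L)
      (sym (trans (cong (_+ℚ eval L) (ℚₚ.*-zeroˡ (val C))) (ℚₚ.+-identityˡ (eval L))))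
    ... | no _ = cong (q *ℚ val C +ℚ_) (dropZeros-eval L)

    normalize-eval : ∀ L → eval (normalize L) ≡ eval L
    normalize-eval L = trans (dropZeros-eval (merge L)) (merge-eval L)

proposition2p2 : (σ : Signature) →
    Σ (Structure σ → List (ℚ × Structure σ)) λ alg →
      (B : Structure σ) →
        All (λ p → proj₁ p ≢ 0ℚ) (alg B) ×
        AllPairs (λ p q → ¬ Iso (proj₂ p) (proj₂ q)) (alg B) ×
        ((A : Structure σ) → toℚ (Condens A B) ≡ linComb (alg B) A)
proposition2p2 σ = normalize ∘ expansion , λ B →
  normalize-nonzero (expansion B) , normalize-nonIsomorphic (expansion B) , λ A →
    trans (expansion-correct A B)
          (sym (normalize-eval (λ C → toℚ (Hom A C)) (λ {C} {D} → cong toℚ ∘ Hom-iso A C D) (expansion B)))
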